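{- Let $G=(V,E)$ be a graph, $T\subseteq V$, and $A\subseteq V$ with $\overline{A}=V\setminus A$. Let $X,W\subseteq A$ be $T$-independent sets such that $X\cap T\equiv^{A}_1 W\cap T$ and $X\setminus T\equiv^{A}_1 W\setminus T$. Then for every $Y\subseteq \overline{A}$, $X\cup Y$ is a $T$-independent set if and only if $W\cup Y$ is a $T$-independent set.
   Context: A set $X\subseteq V$ is a $T$-independent set if $G[X]$ contains no edge incident to a vertex of $T\cap X$. For $A\subseteq V$ and positive integer $d$, two sets $X,W\subseteq A$ are $d$-neighbour equivalent with respect to $A$, written $X\equiv^A_d W$, if $\min\{d,|X\cap N(v)|\}=\min\{d,|W\cap N(v)|\}$ for all $v\in V\setminus A$, where $N(v)$ is the neighbourhood of $v$. -}

module Defs where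

open import Data.Nat using (ℕ; suc; _⊓_)
open import Data.Bool using (Bool; true; false)
open import Data.Fin using (Fin)
open import Data.Fin.Subset using (Subset; _∈_; _∉_; _∩_; ∣_∣)
open import Data.Vec using (tabulate)
open import Data.Product using (_×_)
open import Relation.Binary.PropositionalEquality using (_≡_)
open import Relation.Nullary using (¬_)

record Graph (n : ℕ) : Set where
  field
    adj   : Fin n → Fin n → Bool
    sym   : ∀ u v → adj u v ≡ adj v u
    irrefl : ∀ v → adj v v ≡ false
open Graph public

Edge : ∀ {n} → Graph n → Fin n → Fin n → Set
Edge G u v = adj G u v ≡ true

N : ∀ {n} → Graph n → Fin n → Subset n
N G v = tabulate (adj G v)

T-independent : ∀ {n} → Graph n → Subset n → Subset n → Set
T-independent G T X =
  ∀ u v → u ∈ X → v ∈ X → u ∈ T → ¬ Edge G u v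

NeighbourEquiv : ∀ {n} → Graph n → Subset n → ℕ → Subset n → Subset n → Set
NeighbourEquiv G A d X W =
  ∀ v → v ∉ A → d ⊓ ∣ X ∩ N G v ∣ ≡ d ⊓ ∣ W ∩ N G v ∣

{-# OPTIONS --safe #-}
-- A 1-neighbour equivalence only records, for each outside vertex, whether it has a
-- neighbour in the set. An edge of G[W ∪ Y] with an endpoint in T is either inside W,
-- inside Y, or joins some y ∈ Y to some w ∈ W with w ∈ T or y ∈ T; in the last case y
-- also has a neighbour in X ∩ T (resp. in X ∩ T or X ─ T, whichever part contains w),
-- which yields an edge of G[X ∪ Y] with an endpoint in T.
module Submission where

open import Defs hiding (sym)
open import Data.Nat using (ℕ; _⊓_; s≤s; z≤n)
open import Data.Nat.Properties using (m≤n⇒m⊓n≡m; ≤-trans)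
open import Data.Fin using (Fin; zero; suc)
open import Data.Fin.Subset using (Subset; _⊆_; _∩_; _∪_; _─_; ∁; _∈_; _∉_; ∣_∣; Nonempty; inside; outside)
open import Data.Fin.Subset.Properties
  using (x∈p∩q⁺; x∈p∩q⁻; x∈p∪q⁺; x∈p∪q⁻; x∈∁p⇒x∉p; x∈p∧x∉q⇒x∈p─q; p─q⊆p; _∈?_;
         x∈p⇒∣p-x∣<∣p∣)
open import Data.Vec using ([]; _∷_; here; there)
open import Data.Vec.Properties using (lookup∘tabulate; []=⇒lookup; lookup⇒[]=)
open import Data.Product using (_×_; _,_; ∃-syntax)
open import Data.Sum using (inj₁; inj₂)
open import Function.Bundles using (_⇔_; mk⇔)
open import Relation.Binary.PropositionalEquality using (_≡_; sym; trans)
open import Relation.Nullary using (yes; no)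

private
  variable
    n : ℕ

Nonempty⇒1⊓∣p∣≡1 : {p : Subset n} → Nonempty p → 1 ⊓ ∣ p ∣ ≡ 1
Nonempty⇒1⊓∣p∣≡1 (_ , x∈p) = m≤n⇒m⊓n≡m (≤-trans (s≤s z≤n) (x∈p⇒∣p-x∣<∣p∣ x∈p))

1⊓∣p∣≡1⇒Nonempty : (p : Subset n) → 1 ⊓ ∣ p ∣ ≡ 1 → Nonempty p
1⊓∣p∣≡1⇒Nonempty []            ()
1⊓∣p∣≡1⇒Nonempty (inside  ∷ p) _ = zero , here
1⊓∣p∣≡1⇒Nonempty (outside ∷ p) 1⊓∣p∣≡1 with 1⊓∣p∣≡1⇒Nonempty p 1⊓∣p∣≡1
... | x , x∈p = suc x , there x∈p

module _ (G : Graph n) where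

  Edge-sym : {u v : Fin n} → Edge G u v → Edge G v u
  Edge-sym {u} {v} = trans (Graph.sym G v u)

  Edge⇒∈N : {u v : Fin n} → Edge G v u → u ∈ N G v
  Edge⇒∈N {u} {v} e = lookup⇒[]= u _ (trans (lookup∘tabulate (adj G v) u) e)

  ∈N⇒Edge : {u v : Fin n} → u ∈ N G v → Edge G v u
  ∈N⇒Edge {u} {v} u∈Nv = trans (sym (lookup∘tabulate (adj G v) u)) ([]=⇒lookup u∈Nv)

  NeighbourEquiv-sym : {A : Subset n} {d : ℕ} (S S′ : Subset n) →
    NeighbourEquiv G A d S S′ → NeighbourEquiv G A d S′ S
  NeighbourEquiv-sym _ _ S≡S′ v v∉A = sym (S≡S′ v v∉A)

  HasNeighbourIn : Fin n → Subset n → Set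
  HasNeighbourIn v S = ∃[ u ] u ∈ S × Edge G v u

  1-equivalent⇒HasNeighbourIn : {A S S′ : Subset n} {v : Fin n} →
    NeighbourEquiv G A 1 S S′ → v ∉ A → HasNeighbourIn v S → HasNeighbourIn v S′
  1-equivalent⇒HasNeighbourIn {S′ = S′} {v} S≡S′ v∉A (u , u∈S , e)
    with 1⊓∣p∣≡1⇒Nonempty (S′ ∩ N G v)
           (trans (sym (S≡S′ v v∉A)) (Nonempty⇒1⊓∣p∣≡1 (u , x∈p∩q⁺ (u∈S , Edge⇒∈N e))))
  ... | x , x∈S′∩Nv with x∈p∩q⁻ S′ (N G v) x∈S′∩Nv
  ...   | x∈S′ , x∈Nv = x , x∈S′ , ∈N⇒Edge x∈Nv

  1-equivalent-parts⇒HasNeighbourIn : {T A W X : Subset n} {v : Fin n} →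
    NeighbourEquiv G A 1 (W ∩ T) (X ∩ T) → NeighbourEquiv G A 1 (W ─ T) (X ─ T) →
    v ∉ A → HasNeighbourIn v W → HasNeighbourIn v X
  1-equivalent-parts⇒HasNeighbourIn {T} {X = X} ≡T ≡─T v∉A (w , w∈W , e) with w ∈? T
  ... | yes w∈T with 1-equivalent⇒HasNeighbourIn ≡T v∉A (w , x∈p∩q⁺ (w∈W , w∈T) , e)
  ...   | x , x∈X∩T , e′ with x∈p∩q⁻ X T x∈X∩T
  ...     | x∈X , _ = x , x∈X , e′
  1-equivalent-parts⇒HasNeighbourIn {T} {X = X} ≡T ≡─T v∉A (w , w∈W , e) | no w∉T
    with 1-equivalent⇒HasNeighbourIn ≡─T v∉A (w , x∈p∧x∉q⇒x∈p─q w∈W w∉T , e)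
  ... | x , x∈X─T , e′ = x , p─q⊆p X T x∈X─T , e′

  T-independent-∪-transfer : (T A X W Y : Subset n) →
    T-independent G T W →
    NeighbourEquiv G A 1 (W ∩ T) (X ∩ T) →
    NeighbourEquiv G A 1 (W ─ T) (X ─ T) →
    Y ⊆ ∁ A →
    T-independent G T (X ∪ Y) → T-independent G T (W ∪ Y)
  T-independent-∪-transfer T A X W Y indW ≡T ≡─T Y⊆∁A indXY = independent
    where
      inX : {z : Fin n} → z ∈ X → z ∈ X ∪ Y
      inX z∈X = x∈p∪q⁺ (inj₁ z∈X)

      inY : {z : Fin n} → z ∈ Y → z ∈ X ∪ Y
      inY z∈Y = x∈p∪q⁺ (inj₂ z∈Y)

      ∉A : {z : Fin n} → z ∈ Y → z ∉ A
      ∉A z∈Y = x∈∁p⇒x∉p (Y⊆∁A z∈Y)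

      independent : T-independent G T (W ∪ Y)
      independent u v u∈W∪Y v∈W∪Y u∈T e with x∈p∪q⁻ W Y u∈W∪Y | x∈p∪q⁻ W Y v∈W∪Y
      ... | inj₁ u∈W | inj₁ v∈W = indW u v u∈W v∈W u∈T e
      ... | inj₂ u∈Y | inj₂ v∈Y = indXY u v (inY u∈Y) (inY v∈Y) u∈T e
      ... | inj₁ u∈W | inj₂ v∈Y
        with 1-equivalent⇒HasNeighbourIn ≡T (∉A v∈Y) (u , x∈p∩q⁺ (u∈W , u∈T) , Edge-sym e)
      ...   | x , x∈X∩T , e′ with x∈p∩q⁻ X T x∈X∩T
      ...     | x∈X , x∈T = indXY x v (inX x∈X) (inY v∈Y) x∈T (Edge-sym e′)
      independent u v u∈W∪Y v∈W∪Y u∈T e | inj₂ u∈Y | inj₁ v∈W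
        with 1-equivalent-parts⇒HasNeighbourIn ≡T ≡─T (∉A u∈Y) (v , v∈W , e)
      ... | x , x∈X , e′ = indXY u x (inY u∈Y) (inX x∈X) u∈T e′

lemma6 : {n : ℕ} (G : Graph n) (T A X W : Subset n) →
    X ⊆ A → W ⊆ A →
    T-independent G T X → T-independent G T W →
    NeighbourEquiv G A 1 (X ∩ T) (W ∩ T) →
    NeighbourEquiv G A 1 (X ─ T) (W ─ T) →
    (Y : Subset n) → Y ⊆ ∁ A →
    (T-independent G T (X ∪ Y) ⇔ T-independent G T (W ∪ Y))
lemma6 G T A X W _ _ indX indW ≡T ≡─T Y Y⊆∁A =
  mk⇔ (T-independent-∪-transfer G T A X W Y indW
         (NeighbourEquiv-sym G (X ∩ T) (W ∩ T) ≡T) (NeighbourEquiv-sym G (X ─ T) (W ─ T) ≡─T) Y⊆∁A)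
      (T-independent-∪-transfer G T A W X Y indX ≡T ≡─T Y⊆∁A)
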